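{- Let $\mathcal{G}=(V,E_L,E_R)$ be an achievement positional game with no edge of size $1$ (in $E_L\cup E_R$). Suppose there is a blue (resp. red) edge $\{u,v\}$ such that for all $e\in E_L\cup E_R$, $u\in e$ implies $v\in e$. Then it is optimal for Left (resp. Right) as first player to start by picking $v$, which forces the opponent to answer by picking $u$; that is, $o(\mathcal{G})\leq_L o(\mathcal{G}_v^u)$ (resp. $o(\mathcal{G}^v_u)\leq_L o(\mathcal{G})$).
   Context: An achievement positional game is a triple $\mathcal{G}=(V,E_L,E_R)$ where $V$ is a finite set and $E_L, E_R \subseteq 2^V\setminus\{\varnothing\}$ (blue and red edges). Left and Right alternately pick a previously unpicked vertex; whoever first fills (picks all vertices of) an edge of their own color (blue for Left, red for Right) wins; if no one does before all vertices are picked, the game is a draw. For a set of edges $E$ and $S\subseteq V$, $E^{+S}=\{e\setminus S: e\in E\}$ and $E^{ -S}=\{e\in E: e\cap S=\varnothing\}$. $\mathcal{G}_a^b=(V\setminus\{a,b\}, (E_L^{+\{a\}})^{ -\{b\}}, (E_R^{+\{b\}})^{ -\{a\}})$ is the game after Left has picked $a$ and Right has picked $b$. The outcome $o(\mathcal{G})$ is the pair (result under optimal play when Left starts, result under optimal play when Right starts); $\leq_L$ compares outcomes componentwise from Left's viewpoint with Right win $<$ draw $<$ Left win. -}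

module Defs where

open import Data.Nat using (ℕ; zero; suc; _≡ᵇ_)
open import Data.Bool using (Bool; true; false; if_then_else_; not)
open import Data.Fin using (Fin)
open import Data.Fin.Subset using (Subset; _∈_; _∉_; _⊆_; _-_; ∣_∣; Nonempty; ⁅_⁆; _∪_)
open import Data.Fin.Subset.Properties using (_∈?_)
open import Data.List using (List; []; _∷_; map; filter; foldr; allFin; _++_)
open import Data.Bool.ListAction using (any)
open import Data.List.Membership.Propositional renaming (_∈_ to _∈ₗ_)
open import Data.Product using (_×_; _,_)
open import Relation.Nullary using (¬?)
open import Relation.Nullary.Decidable using (does)

data Result : Set where
  RightWin Draw LeftWin : Result

data _≤R_ : Result → Result → Set where
  RW≤ : ∀ {r} → RightWin ≤R r
  D≤D : Draw ≤R Draw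
  ≤LW : ∀ {r} → r ≤R LeftWin

maxR : Result → Result → Result
maxR LeftWin _ = LeftWin
maxR _ LeftWin = LeftWin
maxR Draw _ = Draw
maxR _ Draw = Draw
maxR RightWin RightWin = RightWin

minR : Result → Result → Result
minR RightWin _ = RightWin
minR _ RightWin = RightWin
minR Draw _ = Draw
minR _ Draw = Draw
minR LeftWin LeftWin = LeftWin

data Player : Set where
  Left Right : Player

-- An achievement positional game on the vertex set V ⊆ Fin n,
-- with blue edges EL and red edges ER.
record Game (n : ℕ) : Set where
  constructor game
  field
    V  : Subset n
    EL : List (Subset n)
    ER : List (Subset n)
open Game public

WellFormed : ∀ {n} → Game n → Set
WellFormed G = ∀ e → e ∈ₗ (EL G ++ ER G) → Nonempty e × e ⊆ V G

plus : ∀ {n} → Fin n → List (Subset n) → List (Subset n)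
plus x E = map (λ e → e - x) E

minus : ∀ {n} → Fin n → List (Subset n) → List (Subset n)
minus x E = filter (λ e → ¬? (x ∈? e)) E

-- G_a^b : Left has picked a and Right has picked b.
after : ∀ {n} → Game n → (a b : Fin n) → Game n
after G a b = game ((V G - a) - b) (minus b (plus a (EL G))) (minus a (plus b (ER G)))

moves : ∀ {n} → Subset n → List (Fin n)
moves V = filter (λ x → x ∈? V) (allFin _)

isEmpty : ∀ {n} → Subset n → Bool
isEmpty e = ∣ e ∣ ≡ᵇ 0

fills : ∀ {n} → Fin n → List (Subset n) → Bool
fills x E = any (λ e → isEmpty (e - x)) E

bestL : List Result → Result
bestL [] = Draw
bestL (r ∷ rs) = foldr maxR r rs

bestR : List Result → Result
bestR [] = Draw
bestR (r ∷ rs) = foldr minR r rs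

-- Optimal-play value with the given player to move; the fuel k is
-- used with k = ∣ V ∣ (each move removes one vertex).  Edges are stored in
-- reduced form (already picked own vertices removed, edges hit by the
-- opponent deleted).  No vertex left ⇒ draw.
value : ∀ {n} → ℕ → Player → Subset n → List (Subset n) → List (Subset n) → Result
value zero _ _ _ _ = Draw
value (suc k) Left V EL ER =
  bestL (map (λ x → if fills x EL then LeftWin
                    else value k Right (V - x) (plus x EL) (minus x ER)) (moves V))
value (suc k) Right V EL ER =
  bestR (map (λ x → if fills x ER then RightWin
                    else value k Left (V - x) (minus x EL) (plus x ER)) (moves V))

result : ∀ {n} → Player → Game n → Result
result p G = value ∣ V G ∣ p (V G) (EL G) (ER G)

Outcome : Set
Outcome = Result × Result

o : ∀ {n} → Game n → Outcome
o G = result Left G , result Right G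

_≤L_ : Outcome → Outcome → Set
(a , b) ≤L (c , d) = (a ≤R c) × (b ≤R d)

-- Right answers a pick of v by u and a pick of u by v, and otherwise plays as in G_v^u.
-- Since every edge through u also passes through v, holding u is worth no more than holding
-- v to either player, so each position reached is at most as good for Left as the
-- corresponding position of G_v^u (Left cannot win by picking v or u alone, as no edge is a
-- singleton); induction on the number of free vertices gives o(G) ≤L o(G_v^u).  The red case
-- is the blue one for the game with the colours exchanged, whose values are the negated ones.
-- The edge {u, v} itself only provides u ≠ v and u, v ∈ V.
module Submission where

open import Defs
open import Level using (0ℓ)
open import Data.Nat using (ℕ; zero; suc; _+_)
open import Data.Nat.Properties using (≡ᵇ⇒≡; ≡⇒≡ᵇ; 0≢1+n; suc-injective)
open import Data.Bool using (true; false; T; if_then_else_)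
open import Data.Fin using (Fin; zero; suc; _≟_)
open import Data.Fin.Subset
  using (Subset; _∈_; _∉_; _⊆_; _-_; _─_; ∣_∣; ⁅_⁆; _∪_; Empty; Nonempty; inside; outside)
open import Data.Fin.Subset.Properties
  using ( _∈?_; nonempty?; Empty-unique; ∣⊥∣≡0; p─⊥≡p; p─q⊆p; x∈⁅x⁆; x∈p∧x≢y⇒x∈p-y
        ; p─x─y≡p─y─x; ∪-idem; ∣⁅x⁆∣≡1; x∈p∪q⁺)
open import Data.Vec using (_∷_; here; there)
open import Data.List using (List; []; _∷_; map; allFin; _++_)
open import Data.List.Membership.Propositional using (lose; find) renaming (_∈_ to _∈ₗ_)
open import Data.List.Membership.Propositional.Properties
  using (∈-map⁺; ∈-map⁻; ∈-filter⁺; ∈-filter⁻; ∈-allFin; ∈-++⁺ˡ; ∈-++⁺ʳ)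
open import Data.List.Properties
  using (map-cong; map-∘; foldr-fusion; foldr-map; foldr-preservesᵇ; foldr-preservesᵒ)
open import Data.List.Relation.Binary.Subset.Propositional using () renaming (_⊆_ to _⊆ₗ_)
open import Data.List.Relation.Binary.Subset.Propositional.Properties
  using (map⁺; filter⁺′; any⁺; module ⊆-Reasoning)
open import Data.List.Relation.Unary.Any as Any using (Any; here; there)
open import Data.List.Relation.Unary.Any.Properties as Any using ()
open import Data.List.Relation.Unary.All as All using ()
open import Data.List.Relation.Unary.All.Properties as All using ()
open import Data.Product using (_×_; _,_; ∃; proj₁; proj₂)
open import Data.Sum using (_⊎_; inj₁; inj₂; [_,_])
open import Function using (_∘_)
open import Relation.Nullary using (¬_; ¬?; yes; no; contradiction)
open import Relation.Binary.Bundles using (TotalPreorder)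
open import Relation.Binary.Structures using (IsTotalPreorder)
open import Relation.Binary.PropositionalEquality hiding ([_])
open import Algebra.Construct.NaturalChoice.Base using (MinOperator; MaxOperator)
import Relation.Binary.Reasoning.Preorder

private variable
  n k : ℕ
  x y u v : Fin n
  p : Subset n
  e : Subset n
  E F : List (Subset n)

x∈p─q⇒x∉q : ∀ {q} → x ∈ p ─ q → x ∉ q
x∈p─q⇒x∉q {p = _ ∷ p} {outside ∷ q} here        ()
x∈p─q⇒x∉q {p = _ ∷ p} {_       ∷ q} (there x∈) (there x∈q) = x∈p─q⇒x∉q x∈ x∈q

x∈p-y⇒x≢y : x ∈ p - y → x ≢ y
x∈p-y⇒x≢y {y = y} x∈ refl = x∈p─q⇒x∉q x∈ (x∈⁅x⁆ y)

x∈p-y⇒x∈p : x ∈ p - y → x ∈ p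
x∈p-y⇒x∈p = p─q⊆p _ _

x∉p⇒p-x≡p : x ∉ p → p - x ≡ p
x∉p⇒p-x≡p {x = zero}  {outside ∷ p} _   = cong (outside ∷_) (p─⊥≡p p)
x∉p⇒p-x≡p {x = zero}  {inside  ∷ p} x∉ = contradiction here x∉
x∉p⇒p-x≡p {x = suc x} {s       ∷ p} x∉ = cong (s ∷_) (x∉p⇒p-x≡p (x∉ ∘ there))

x∈p⇒∣p∣≡1+∣p-x∣ : x ∈ p → ∣ p ∣ ≡ suc ∣ p - x ∣
x∈p⇒∣p∣≡1+∣p-x∣ {x = zero}  {inside ∷ p}  here      = cong (suc ∘ ∣_∣) (sym (p─⊥≡p p))
x∈p⇒∣p∣≡1+∣p-x∣ {x = suc x} {inside ∷ p}  (there x∈) = cong suc (x∈p⇒∣p∣≡1+∣p-x∣ x∈)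
x∈p⇒∣p∣≡1+∣p-x∣ {x = suc x} {outside ∷ p} (there x∈) = x∈p⇒∣p∣≡1+∣p-x∣ x∈

x∈p⇒∣p∣≢0 : x ∈ p → ∣ p ∣ ≢ 0
x∈p⇒∣p∣≢0 x∈ ∣p∣≡0 = 0≢1+n (trans (sym ∣p∣≡0) (x∈p⇒∣p∣≡1+∣p-x∣ x∈))

p-x-y-z≡p-y-z-x : ∀ (p : Subset n) x y z → p - x - y - z ≡ p - y - z - x
p-x-y-z≡p-y-z-x p x y z = trans (cong (_- z) (p─x─y≡p─y─x p x y)) (p─x─y≡p─y─x (p - y) x z)

∣p-x-y-z∣≡k : ∀ {p : Subset n} {x y z k} →
  ∣ p - y - z ∣ ≡ suc k → x ∈ p - y - z → ∣ p - x - y - z ∣ ≡ k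
∣p-x-y-z∣≡k {p = p} {x} {y} {z} {k} ∣p-y-z∣≡1+k x∈ = suc-injective (begin
  suc ∣ p - x - y - z ∣  ≡⟨ cong (suc ∘ ∣_∣) (p-x-y-z≡p-y-z-x p x y z) ⟩
  suc ∣ p - y - z - x ∣  ≡⟨ x∈p⇒∣p∣≡1+∣p-x∣ x∈ ⟨
  ∣ p - y - z ∣          ≡⟨ ∣p-y-z∣≡1+k ⟩
  suc k                  ∎)
  where open ≡-Reasoning

Empty⇒∣p∣≡0 : ∀ {p : Subset n} → Empty p → ∣ p ∣ ≡ 0
Empty⇒∣p∣≡0 {n = n} empty = trans (cong ∣_∣ (Empty-unique empty)) (∣⊥∣≡0 n)

∣p∣≡1+k⇒Nonempty : ∣ p ∣ ≡ suc k → Nonempty p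
∣p∣≡1+k⇒Nonempty {p = p} ∣p∣≡1+k with nonempty? p
... | yes ne = ne
... | no  ¬ne = contradiction (trans (sym (Empty⇒∣p∣≡0 ¬ne)) ∣p∣≡1+k) 0≢1+n

isEmpty⁺ : Empty p → T (isEmpty p)
isEmpty⁺ empty = ≡⇒≡ᵇ _ 0 (Empty⇒∣p∣≡0 empty)

isEmpty⁻ : T (isEmpty p) → Empty p
isEmpty⁻ {p = p} t (x , x∈) = 0≢1+n (trans (sym (≡ᵇ⇒≡ ∣ p ∣ 0 t)) (x∈p⇒∣p∣≡1+∣p-x∣ x∈))

Nonempty∧Empty[p-x]⇒∣p∣≡1 : Nonempty p → Empty (p - x) → ∣ p ∣ ≡ 1
Nonempty∧Empty[p-x]⇒∣p∣≡1 {p = p} {x} (y , y∈) empty with x ∈? p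
... | yes x∈ = trans (x∈p⇒∣p∣≡1+∣p-x∣ x∈) (cong suc (Empty⇒∣p∣≡0 empty))
... | no  x∉ = contradiction (y , subst (y ∈_) (sym (x∉p⇒p-x≡p x∉)) y∈) empty

∈-plus⁺ : e ∈ₗ E → e - x ∈ₗ plus x E
∈-plus⁺ = ∈-map⁺ _

∈-plus⁻ : e ∈ₗ plus x E → ∃ λ e′ → e′ ∈ₗ E × e ≡ e′ - x
∈-plus⁻ = ∈-map⁻ _

∈-minus⁺ : e ∈ₗ E → x ∉ e → e ∈ₗ minus x E
∈-minus⁺ = ∈-filter⁺ _

∈-minus⁻ : e ∈ₗ minus x E → e ∈ₗ E × x ∉ e
∈-minus⁻ {E = E} = ∈-filter⁻ _ {xs = E}

plus-mono : ∀ (x : Fin n) → E ⊆ₗ F → plus x E ⊆ₗ plus x F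
plus-mono x = map⁺ (_- x)

minus-mono : ∀ (x : Fin n) → E ⊆ₗ F → minus x E ⊆ₗ minus x F
minus-mono x = filter⁺′ (¬? ∘ (x ∈?_)) (¬? ∘ (x ∈?_)) (λ x∉ → x∉)

minus-⊆ : ∀ (x : Fin n) E → minus x E ⊆ₗ E
minus-⊆ x E = proj₁ ∘ ∈-minus⁻ {x = x} {E = E}

minus-⊆-plus : ∀ (x : Fin n) E → minus x E ⊆ₗ plus x E
minus-⊆-plus x E e∈ with ∈-minus⁻ {x = x} {E = E} e∈
... | e∈E , x∉ = subst (_∈ₗ _) (x∉p⇒p-x≡p x∉) (∈-plus⁺ e∈E)

plus-comm : ∀ (x y : Fin n) E → plus x (plus y E) ≡ plus y (plus x E)
plus-comm x y E = begin
  map (_- x) (map (_- y) E)   ≡⟨ map-∘ E ⟨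
  map (λ e → e - y - x) E     ≡⟨ map-cong (λ e → p─x─y≡p─y─x e y x) E ⟩
  map (λ e → e - x - y) E     ≡⟨ map-∘ E ⟩
  map (_- y) (map (_- x) E)   ∎
  where open ≡-Reasoning

minus-comm : ∀ (x y : Fin n) E → minus x (minus y E) ⊆ₗ minus y (minus x E)
minus-comm x y E e∈ with ∈-minus⁻ {x = x} {E = minus y E} e∈
... | e∈′ , x∉ with ∈-minus⁻ {x = y} {E = E} e∈′
... | e∈E , y∉ = ∈-minus⁺ (∈-minus⁺ e∈E x∉) y∉

plus-minus : ∀ (x y : Fin n) E → plus x (minus y E) ⊆ₗ minus y (plus x E)
plus-minus x y E e∈ with ∈-plus⁻ {x = x} {E = minus y E} e∈
... | e , e∈′ , refl with ∈-minus⁻ {x = y} {E = E} e∈′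
... | e∈E , y∉ = ∈-minus⁺ (∈-plus⁺ e∈E) (y∉ ∘ x∈p-y⇒x∈p)

minus-plus : y ≢ x → ∀ E → minus y (plus x E) ⊆ₗ plus x (minus y E)
minus-plus {y = y} {x} y≢x E e∈ with ∈-minus⁻ {x = y} {E = plus x E} e∈
... | e∈′ , y∉ with ∈-plus⁻ {x = x} {E = E} e∈′
... | e , e∈E , refl = ∈-plus⁺ (∈-minus⁺ e∈E (y∉ ∘ λ y∈ → x∈p∧x≢y⇒x∈p-y y∈ y≢x))

fills⁺ : e ∈ₗ E → Empty (e - x) → T (fills x E)
fills⁺ e∈ empty = Any.any⁺ _ (lose e∈ (isEmpty⁺ empty))

fills⁻ : ∀ E → T (fills x E) → ∃ λ e → e ∈ₗ E × Empty (e - x)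
fills⁻ E t with find (Any.any⁻ _ E t)
... | e , e∈ , t′ = e , e∈ , isEmpty⁻ t′

fills-mono : E ⊆ₗ F → T (fills x E) → T (fills x F)
fills-mono = any⁺ _

fills-plus : ∀ E → T (fills x E) → T (fills y (plus x E))
fills-plus E t with fills⁻ E t
... | e , e∈ , empty = fills⁺ (∈-plus⁺ e∈) (λ (z , z∈) → empty (z , x∈p-y⇒x∈p z∈))

fills-plus-comm : ∀ E → T (fills x (plus y E)) → T (fills y (plus x E))
fills-plus-comm {x = x} {y} E t with fills⁻ (plus y E) t
... | e′ , e′∈ , empty with ∈-plus⁻ {x = y} {E = E} e′∈
... | e , e∈ , refl = fills⁺ (∈-plus⁺ e∈) (subst Empty (p─x─y≡p─y─x e y x) empty)

fills-minus : y ≢ x → ∀ E → T (fills x E) → T (fills x (minus y E))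
fills-minus y≢x E t with fills⁻ E t
... | e , e∈ , empty = fills⁺ (∈-minus⁺ e∈ (λ y∈ → empty (_ , x∈p∧x≢y⇒x∈p-y y∈ y≢x))) empty

Dominated : Fin n → Fin n → List (Subset n) → Set
Dominated u v E = ∀ {e} → e ∈ₗ E → u ∈ e → v ∈ e

Dominated-⊆ : E ⊆ₗ F → Dominated u v F → Dominated u v E
Dominated-⊆ E⊆F dom e∈ = dom (E⊆F e∈)

Dominated-plus : v ≢ x → Dominated u v E → Dominated u v (plus x E)
Dominated-plus {x = x} {E = E} v≢x dom e′∈ u∈ with ∈-plus⁻ {x = x} {E = E} e′∈
... | e , e∈ , refl = x∈p∧x≢y⇒x∈p-y (dom e∈ (x∈p-y⇒x∈p u∈)) v≢x

fills-dominated : v ≢ u → Dominated u v E → T (fills u E) → T (fills v E)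
fills-dominated {v = v} {u} {E} v≢u dom t with fills⁻ E t
... | e , e∈ , empty = fills⁺ e∈ (λ (y , y∈) → empty (y , y∈e-u y (x∈p-y⇒x∈p y∈)))
  where
  y∈e-u : ∀ y → y ∈ e → y ∈ e - u
  y∈e-u y y∈ with y ≟ u
  ... | yes refl = contradiction (x∈p∧x≢y⇒x∈p-y (dom e∈ y∈) v≢u) (λ v∈ → empty (v , v∈))
  ... | no  y≢u  = x∈p∧x≢y⇒x∈p-y y∈ y≢u

minus-plus-dominated : v ≢ u → Dominated u v E → minus v (plus u E) ⊆ₗ minus v (minus u E)
minus-plus-dominated {v = v} {u} {E} v≢u dom e′∈ with ∈-minus⁻ {x = v} {E = plus u E} e′∈
... | e′∈′ , v∉ with ∈-plus⁻ {x = u} {E = E} e′∈′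
... | e , e∈ , refl = subst (_∈ₗ _) (sym (x∉p⇒p-x≡p u∉)) (∈-minus⁺ (∈-minus⁺ e∈ u∉) v∉e)
  where
  v∉e : v ∉ e
  v∉e v∈ = v∉ (x∈p∧x≢y⇒x∈p-y v∈ v≢u)
  u∉ : u ∉ e
  u∉ = v∉e ∘ dom e∈

≤R-refl : ∀ {a} → a ≤R a
≤R-refl {RightWin} = RW≤
≤R-refl {Draw}     = D≤D
≤R-refl {LeftWin}  = ≤LW

≤R-reflexive : ∀ {a b} → a ≡ b → a ≤R b
≤R-reflexive refl = ≤R-refl

≤R-trans : ∀ {a b c} → a ≤R b → b ≤R c → a ≤R c
≤R-trans RW≤ _   = RW≤
≤R-trans D≤D q   = q
≤R-trans ≤LW ≤LW = ≤LW

≤R-total : ∀ a b → a ≤R b ⊎ b ≤R a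
≤R-total RightWin b        = inj₁ RW≤
≤R-total a        LeftWin  = inj₁ ≤LW
≤R-total Draw     RightWin = inj₂ RW≤
≤R-total Draw     Draw     = inj₁ D≤D
≤R-total LeftWin  b        = inj₂ ≤LW

≤R-isTotalPreorder : IsTotalPreorder _≡_ _≤R_
≤R-isTotalPreorder = record
  { isPreorder = record
    { isEquivalence = isEquivalence
    ; reflexive     = ≤R-reflexive
    ; trans         = ≤R-trans
    }
  ; total = ≤R-total
  }

≤R-totalPreorder : TotalPreorder 0ℓ 0ℓ 0ℓ
≤R-totalPreorder = record { isTotalPreorder = ≤R-isTotalPreorder }

minR-≤ : ∀ {a b} → a ≤R b → minR a b ≡ a
minR-≤ RW≤ = refl
minR-≤ D≤D = refl
minR-≤ {RightWin} ≤LW = refl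
minR-≤ {Draw}     ≤LW = refl
minR-≤ {LeftWin}  ≤LW = refl

minR-≥ : ∀ {a b} → b ≤R a → minR a b ≡ b
minR-≥ {RightWin} RW≤ = refl
minR-≥ {Draw}     RW≤ = refl
minR-≥ {LeftWin}  RW≤ = refl
minR-≥ D≤D = refl
minR-≥ {b = RightWin} ≤LW = refl
minR-≥ {b = Draw}     ≤LW = refl
minR-≥ {b = LeftWin}  ≤LW = refl

maxR-≤ : ∀ {a b} → a ≤R b → maxR a b ≡ b
maxR-≤ {b = RightWin} RW≤ = refl
maxR-≤ {b = Draw}     RW≤ = refl
maxR-≤ {b = LeftWin}  RW≤ = refl
maxR-≤ D≤D = refl
maxR-≤ {RightWin} ≤LW = refl
maxR-≤ {Draw}     ≤LW = refl
maxR-≤ {LeftWin}  ≤LW = refl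

maxR-≥ : ∀ {a b} → b ≤R a → maxR a b ≡ a
maxR-≥ {RightWin} RW≤ = refl
maxR-≥ {Draw}     RW≤ = refl
maxR-≥ {LeftWin}  RW≤ = refl
maxR-≥ D≤D = refl
maxR-≥ ≤LW = refl

minR-operator : MinOperator ≤R-totalPreorder
minR-operator = record { _⊓_ = minR ; x≤y⇒x⊓y≈x = minR-≤ ; x≥y⇒x⊓y≈y = minR-≥ }

maxR-operator : MaxOperator ≤R-totalPreorder
maxR-operator = record { _⊔_ = maxR ; x≤y⇒x⊔y≈y = maxR-≤ ; x≥y⇒x⊔y≈x = maxR-≥ }

open import Algebra.Construct.NaturalChoice.MinMaxOp minR-operator maxR-operator
  using ( ⊓-glb; ⊔-lub; x≤y⇒x≤y⊔z; x≤y⇒x≤z⊔y; x≤y⇒x⊓z≤y; x≤y⇒z⊓x≤y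
        ; antimono-≤-distrib-⊓; antimono-≤-distrib-⊔)

negR : Result → Result
negR RightWin = LeftWin
negR Draw     = Draw
negR LeftWin  = RightWin

negR-antitone : ∀ {a b} → a ≤R b → negR b ≤R negR a
negR-antitone {b = RightWin} RW≤ = ≤LW
negR-antitone {b = Draw}     RW≤ = ≤LW
negR-antitone {b = LeftWin}  RW≤ = RW≤
negR-antitone D≤D = D≤D
negR-antitone ≤LW = RW≤

negR-minR : ∀ a b → negR (minR a b) ≡ maxR (negR a) (negR b)
negR-minR = antimono-≤-distrib-⊓ (cong negR) negR-antitone

negR-maxR : ∀ a b → negR (maxR a b) ≡ minR (negR a) (negR b)
negR-maxR = antimono-≤-distrib-⊔ (cong negR) negR-antitone

module _ {X : Set} (f : X → Result) where

  bestL-ub : ∀ {xs x} → x ∈ₗ xs → f x ≤R bestL (map f xs)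
  bestL-ub {y ∷ ys} x∈ =
    foldr-preservesᵒ (λ a b → [ x≤y⇒x≤y⊔z b , x≤y⇒x≤z⊔y a ]) (f y) (map f ys) (headOrTail x∈)
    where
    headOrTail : ∀ {x} → x ∈ₗ y ∷ ys → f x ≤R f y ⊎ Any (f x ≤R_) (map f ys)
    headOrTail (here refl) = inj₁ ≤R-refl
    headOrTail (there x∈)  = inj₂ (Any.map⁺ (Any.map (λ { refl → ≤R-refl }) x∈))

  bestR-lb : ∀ {xs x} → x ∈ₗ xs → bestR (map f xs) ≤R f x
  bestR-lb {y ∷ ys} x∈ =
    foldr-preservesᵒ (λ a b → [ x≤y⇒x⊓z≤y b , x≤y⇒z⊓x≤y a ]) (f y) (map f ys) (headOrTail x∈)
    where
    headOrTail : ∀ {x} → x ∈ₗ y ∷ ys → f y ≤R f x ⊎ Any (_≤R f x) (map f ys)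
    headOrTail (here refl) = inj₁ ≤R-refl
    headOrTail (there x∈)  = inj₂ (Any.map⁺ (Any.map (λ { refl → ≤R-refl }) x∈))

  -- The element x only excludes xs = [], for which bestL and bestR return Draw.
  bestL-lub : ∀ {xs x b} → x ∈ₗ xs → (∀ {y} → y ∈ₗ xs → f y ≤R b) → bestL (map f xs) ≤R b
  bestL-lub {_ ∷ _} {b = b} _ bound =
    foldr-preservesᵇ {P = _≤R b} ⊔-lub (bound (here refl)) (All.map⁺ (All.tabulate (bound ∘ there)))

  bestR-glb : ∀ {xs x b} → x ∈ₗ xs → (∀ {y} → y ∈ₗ xs → b ≤R f y) → b ≤R bestR (map f xs)
  bestR-glb {_ ∷ _} {b = b} _ bound =
    foldr-preservesᵇ {P = b ≤R_} ⊓-glb (bound (here refl)) (All.map⁺ (All.tabulate (bound ∘ there)))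

module _ {X : Set} {f g : X → Result} (f≤g : ∀ x → f x ≤R g x) where

  bestL-mono : ∀ xs → bestL (map f xs) ≤R bestL (map g xs)
  bestL-mono []      = D≤D
  bestL-mono (x ∷ xs) = bestL-lub f {x ∷ xs} (here refl) (λ y∈ → ≤R-trans (f≤g _) (bestL-ub g y∈))

  bestR-mono : ∀ xs → bestR (map f xs) ≤R bestR (map g xs)
  bestR-mono []      = D≤D
  bestR-mono (x ∷ xs) = bestR-glb g {x ∷ xs} (here refl) (λ y∈ → ≤R-trans (bestR-lb f y∈) (f≤g _))

negR-bestR : ∀ rs → negR (bestR rs) ≡ bestL (map negR rs)
negR-bestR []       = refl
negR-bestR (r ∷ rs) = trans (foldr-fusion negR r negR-minR rs) (sym (foldr-map maxR negR (negR r) rs))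

negR-bestL : ∀ rs → negR (bestL rs) ≡ bestR (map negR rs)
negR-bestL []       = refl
negR-bestL (r ∷ rs) = trans (foldr-fusion negR r negR-maxR rs) (sym (foldr-map minR negR (negR r) rs))

module ≤R-Reasoning = Relation.Binary.Reasoning.Preorder (TotalPreorder.preorder ≤R-totalPreorder)

private variable
  A B : List (Subset n)
  r : Result

∈-moves⁺ : ∀ {V} → x ∈ V → x ∈ₗ moves V
∈-moves⁺ {x = x} {V = V} x∈ = ∈-filter⁺ (_∈? V) (∈-allFin x) x∈

∈-moves⁻ : ∀ {V : Subset n} → x ∈ₗ moves V → x ∈ V
∈-moves⁻ {n} {V = V} x∈ = proj₂ (∈-filter⁻ (_∈? V) {xs = allFin n} x∈)

-- value (suc k) Left V A B is bestL (map (leftMove k V A B) (moves V)), and dually for Right.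
leftMove : ℕ → Subset n → List (Subset n) → List (Subset n) → Fin n → Result
leftMove k V A B x = if fills x A then LeftWin else value k Right (V - x) (plus x A) (minus x B)

rightMove : ℕ → Subset n → List (Subset n) → List (Subset n) → Fin n → Result
rightMove k V A B y = if fills y B then RightWin else value k Left (V - y) (minus y A) (plus y B)

leftMove-continue : ∀ k V A B (x : Fin n) →
  ¬ T (fills x A) → leftMove k V A B x ≡ value k Right (V - x) (plus x A) (minus x B)
leftMove-continue k V A B x ¬win with fills x A
... | true  = contradiction _ ¬win
... | false = refl

rightMove-continue : ∀ k V A B (y : Fin n) →
  ¬ T (fills y B) → rightMove k V A B y ≡ value k Left (V - y) (minus y A) (plus y B)
rightMove-continue k V A B y ¬win with fills y B
... | true  = contradiction _ ¬win
... | false = refl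

≤-leftMove : ∀ k V A B (x : Fin n) →
  (¬ T (fills x A) → r ≤R value k Right (V - x) (plus x A) (minus x B)) → r ≤R leftMove k V A B x
≤-leftMove k V A B x bound with fills x A
... | true  = ≤LW
... | false = bound λ ()

rightMove-≤ : ∀ k V A B (y : Fin n) →
  (¬ T (fills y B) → value k Left (V - y) (minus y A) (plus y B) ≤R r) → rightMove k V A B y ≤R r
rightMove-≤ k V A B y bound with fills y B
... | true  = RW≤
... | false = bound λ ()

value-mono : ∀ k p (V : Subset n) {A A′ B B′} →
  A ⊆ₗ A′ → B′ ⊆ₗ B → value k p V A B ≤R value k p V A′ B′
value-mono zero    _     _ _   _   = D≤D
value-mono (suc k) Left  V {A} {A′} {B} {B′} A⊆ B⊇ = bestL-mono step (moves V)
  where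
  step : ∀ x → leftMove k V A B x ≤R leftMove k V A′ B′ x
  step x = ≤-leftMove k V A′ B′ x λ ¬win′ → begin
    leftMove k V A B x                             ≡⟨ leftMove-continue k V A B x (¬win′ ∘ fills-mono A⊆) ⟩
    value k Right (V - x) (plus x A) (minus x B)   ≲⟨ value-mono k Right (V - x) (plus-mono x A⊆) (minus-mono x B⊇) ⟩
    value k Right (V - x) (plus x A′) (minus x B′) ∎
    where open ≤R-Reasoning
value-mono (suc k) Right V {A} {A′} {B} {B′} A⊆ B⊇ = bestR-mono step (moves V)
  where
  step : ∀ y → rightMove k V A B y ≤R rightMove k V A′ B′ y
  step y = rightMove-≤ k V A B y λ ¬win → begin
    value k Left (V - y) (minus y A) (plus y B)    ≲⟨ value-mono k Left (V - y) (minus-mono y A⊆) (plus-mono y B⊇) ⟩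
    value k Left (V - y) (minus y A′) (plus y B′)  ≡⟨ rightMove-continue k V A′ B′ y (¬win ∘ fills-mono B⊇) ⟨
    rightMove k V A′ B′ y                          ∎
    where open ≤R-Reasoning

opponent : Player → Player
opponent Left  = Right
opponent Right = Left

value-dual : ∀ k p (V : Subset n) A B → value k p V A B ≡ negR (value k (opponent p) V B A)
value-dual zero    _     _ _ _ = refl
value-dual (suc k) Left  V A B = begin
  bestL (map (leftMove k V A B) (moves V))              ≡⟨ cong bestL (map-cong step (moves V)) ⟩
  bestL (map (negR ∘ rightMove k V B A) (moves V))      ≡⟨ cong bestL (map-∘ (moves V)) ⟩
  bestL (map negR (map (rightMove k V B A) (moves V)))  ≡⟨ negR-bestR (map (rightMove k V B A) (moves V)) ⟨
  negR (bestR (map (rightMove k V B A) (moves V)))      ∎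
  where
  open ≡-Reasoning
  step : ∀ x → leftMove k V A B x ≡ negR (rightMove k V B A x)
  step x with fills x A
  ... | true  = refl
  ... | false = value-dual k Right (V - x) (plus x A) (minus x B)
value-dual (suc k) Right V A B = begin
  bestR (map (rightMove k V A B) (moves V))             ≡⟨ cong bestR (map-cong step (moves V)) ⟩
  bestR (map (negR ∘ leftMove k V B A) (moves V))       ≡⟨ cong bestR (map-∘ (moves V)) ⟩
  bestR (map negR (map (leftMove k V B A) (moves V)))   ≡⟨ negR-bestL (map (leftMove k V B A) (moves V)) ⟨
  negR (bestL (map (leftMove k V B A) (moves V)))       ∎
  where
  open ≡-Reasoning
  step : ∀ y → rightMove k V A B y ≡ negR (leftMove k V B A y)
  step y with fills y B
  ... | true  = refl
  ... | false = value-dual k Left (V - y) (minus y A) (plus y B)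

swap : Game n → Game n
swap (game V EL ER) = game V ER EL

result-swap : ∀ p (G : Game n) → result p G ≡ negR (result (opponent p) (swap G))
result-swap p (game V EL ER) = value-dual ∣ V ∣ p V EL ER

after-swap : ∀ (G : Game n) u v → after (swap G) v u ≡ swap (after G u v)
after-swap (game V EL ER) u v = cong (λ W → game W (minus u (plus v ER)) (minus v (plus u EL))) (p─x─y≡p─y─x V v u)

-- The pairing strategy

module Pairing {u v : Fin n} (v≢u : v ≢ u) where

  pairedL : List (Subset n) → List (Subset n)
  pairedL A = minus u (plus v A)

  pairedR : List (Subset n) → List (Subset n)
  pairedR B = minus v (plus u B)

  record Pairable (V : Subset n) (A B : List (Subset n)) : Set where
    field
      u∈V        : u ∈ V
      v∈V        : v ∈ V
      dominatedL : Dominated u v A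
      dominatedR : Dominated u v B
      v-loses    : ¬ T (fills v A)

  open Pairable

  u≢v : u ≢ v
  u≢v = v≢u ∘ sym

  pairedR-⊆ : Dominated u v B → pairedR B ⊆ₗ B
  pairedR-⊆ {B = B} dom = minus-⊆ u B ∘ minus-⊆ v (minus u B) ∘ minus-plus-dominated v≢u dom

  -- Left picking u and Right answering v leaves Left fewer and Right more edges than G_v^u.
  swap-⊆-pairedL : Dominated u v A → minus v (plus u A) ⊆ₗ pairedL A
  swap-⊆-pairedL {A = A} dom = begin
    minus v (plus u A)   ⊆⟨ minus-plus-dominated v≢u dom ⟩
    minus v (minus u A)  ⊆⟨ minus-comm v u A ⟩
    minus u (minus v A)  ⊆⟨ minus-mono u (minus-⊆-plus v A) ⟩
    minus u (plus v A)   ∎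
    where open ⊆-Reasoning (Subset n)

  pairedR-⊆-swap : Dominated u v B → pairedR B ⊆ₗ plus v (minus u B)
  pairedR-⊆-swap {B = B} dom = minus-⊆-plus v (minus u B) ∘ minus-plus-dominated v≢u dom

  pairedL-plus : u ≢ x → ∀ A → pairedL (plus x A) ⊆ₗ plus x (pairedL A)
  pairedL-plus {x = x} u≢x A = begin
    minus u (plus v (plus x A))  ≡⟨ cong (minus u) (plus-comm v x A) ⟩
    minus u (plus x (plus v A))  ⊆⟨ minus-plus u≢x (plus v A) ⟩
    plus x (minus u (plus v A))  ∎
    where open ⊆-Reasoning (Subset n)

  minus-pairedR : x ≢ u → ∀ B → minus x (pairedR B) ⊆ₗ pairedR (minus x B)
  minus-pairedR {x = x} x≢u B = begin
    minus x (minus v (plus u B))  ⊆⟨ minus-comm x v (plus u B) ⟩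
    minus v (minus x (plus u B))  ⊆⟨ minus-mono v (minus-plus x≢u B) ⟩
    minus v (plus u (minus x B))  ∎
    where open ⊆-Reasoning (Subset n)

  pairedL-minus : ∀ A → pairedL (minus y A) ⊆ₗ minus y (pairedL A)
  pairedL-minus {y = y} A = begin
    minus u (plus v (minus y A))  ⊆⟨ minus-mono u (plus-minus v y A) ⟩
    minus u (minus y (plus v A))  ⊆⟨ minus-comm u y (plus v A) ⟩
    minus y (minus u (plus v A))  ∎
    where open ⊆-Reasoning (Subset n)

  plus-pairedR : ∀ B → plus y (pairedR B) ⊆ₗ pairedR (plus y B)
  plus-pairedR {y = y} B = begin
    plus y (minus v (plus u B))  ⊆⟨ plus-minus y v (plus u B) ⟩
    minus v (plus y (plus u B))  ≡⟨ cong (minus v) (plus-comm y u B) ⟩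
    minus v (plus u (plus y B))  ∎
    where open ⊆-Reasoning (Subset n)

  fills-pairedL : u ≢ x → ∀ A → T (fills v (plus x A)) → T (fills x (pairedL A))
  fills-pairedL u≢x A = fills-minus u≢x (plus v A) ∘ fills-plus-comm A

  Pairable-leftMove : ∀ {V A B} → x ∈ V - v - u → ¬ T (fills x (pairedL A))
    → Pairable V A B → Pairable (V - x) (plus x A) (minus x B)
  Pairable-leftMove {x = x} {A = A} {B} x∈W ¬win P = record
    { u∈V        = x∈p∧x≢y⇒x∈p-y (u∈V P) (x≢u ∘ sym)
    ; v∈V        = x∈p∧x≢y⇒x∈p-y (v∈V P) (x≢v ∘ sym)
    ; dominatedL = Dominated-plus (x≢v ∘ sym) (dominatedL P)
    ; dominatedR = Dominated-⊆ (minus-⊆ x B) (dominatedR P)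
    ; v-loses    = ¬win ∘ fills-pairedL (x≢u ∘ sym) A
    }
    where
    x≢u = x∈p-y⇒x≢y x∈W
    x≢v = x∈p-y⇒x≢y (x∈p-y⇒x∈p x∈W)

  Pairable-rightMove : ∀ {V A B} → y ∈ V - v - u → Pairable V A B → Pairable (V - y) (minus y A) (plus y B)
  Pairable-rightMove {y = y} {A = A} y∈W P = record
    { u∈V        = x∈p∧x≢y⇒x∈p-y (u∈V P) (y≢u ∘ sym)
    ; v∈V        = x∈p∧x≢y⇒x∈p-y (v∈V P) (y≢v ∘ sym)
    ; dominatedL = Dominated-⊆ (minus-⊆ y A) (dominatedL P)
    ; dominatedR = Dominated-plus (y≢v ∘ sym) (dominatedR P)
    ; v-loses    = v-loses P ∘ fills-mono (minus-⊆ y A)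
    }
    where
    y≢u = x∈p-y⇒x≢y y∈W
    y≢v = x∈p-y⇒x≢y (x∈p-y⇒x∈p y∈W)

  PairingBound : ℕ → Set
  PairingBound k = ∀ p {V A B} → ∣ V - v - u ∣ ≡ k → Pairable V A B
    → value (2 + k) p V A B ≤R value k p (V - v - u) (pairedL A) (pairedR B)

  left-takes-v : ∀ k {V A B} → Pairable V A B
    → leftMove (suc k) V A B v ≤R value k Left (V - v - u) (pairedL A) (pairedR B)
  left-takes-v k {V} {A} {B} P = begin
    leftMove (suc k) V A B v                            ≡⟨ leftMove-continue (suc k) V A B v (v-loses P) ⟩
    value (suc k) Right (V - v) (plus v A) (minus v B)  ≲⟨ bestR-lb (rightMove k (V - v) (plus v A) (minus v B)) u∈ ⟩
    rightMove k (V - v) (plus v A) (minus v B) u        ≲⟨ rightMove-≤ k (V - v) (plus v A) (minus v B) u answer ⟩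
    value k Left (V - v - u) (pairedL A) (pairedR B)    ∎
    where
    open ≤R-Reasoning
    u∈ = ∈-moves⁺ (x∈p∧x≢y⇒x∈p-y (u∈V P) u≢v)
    answer = λ _ → value-mono k Left (V - v - u) (λ e∈ → e∈) (minus-plus v≢u B)

  left-takes-u : ∀ k {V A B} → Pairable V A B
    → leftMove (suc k) V A B u ≤R value k Left (V - v - u) (pairedL A) (pairedR B)
  left-takes-u k {V} {A} {B} P = begin
    leftMove (suc k) V A B u                                      ≡⟨ leftMove-continue (suc k) V A B u ¬win ⟩
    value (suc k) Right (V - u) (plus u A) (minus u B)
      ≲⟨ bestR-lb (rightMove k (V - u) (plus u A) (minus u B)) v∈ ⟩
    rightMove k (V - u) (plus u A) (minus u B) v
      ≲⟨ rightMove-≤ k (V - u) (plus u A) (minus u B) v (λ _ → ≤R-refl) ⟩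
    value k Left (V - u - v) (minus v (plus u A)) (plus v (minus u B))
      ≡⟨ cong (λ W → value k Left W (minus v (plus u A)) (plus v (minus u B))) (p─x─y≡p─y─x V u v) ⟩
    value k Left (V - v - u) (minus v (plus u A)) (plus v (minus u B))
      ≲⟨ value-mono k Left (V - v - u) (swap-⊆-pairedL (dominatedL P)) (pairedR-⊆-swap (dominatedR P)) ⟩
    value k Left (V - v - u) (pairedL A) (pairedR B)              ∎
    where
    open ≤R-Reasoning
    ¬win = v-loses P ∘ fills-dominated v≢u (dominatedL P)
    v∈ = ∈-moves⁺ (x∈p∧x≢y⇒x∈p-y (v∈V P) v≢u)

  left-bound : ∀ k {V A B} → Pairable V A B
    → (∀ {x} → x ∈ V - v - u → leftMove (suc k) V A B x ≤R value k Left (V - v - u) (pairedL A) (pairedR B))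
    → value (2 + k) Left V A B ≤R value k Left (V - v - u) (pairedL A) (pairedR B)
  left-bound k {V} {A} {B} P others = bestL-lub (leftMove (suc k) V A B) (∈-moves⁺ (v∈V P)) bound
    where
    bound : ∀ {x} → x ∈ₗ moves V → leftMove (suc k) V A B x ≤R value k Left (V - v - u) (pairedL A) (pairedR B)
    bound {x} x∈ with x ≟ v | x ≟ u
    ... | yes refl | _        = left-takes-v k P
    ... | no _     | yes refl = left-takes-u k P
    ... | no x≢v   | no x≢u   = others (x∈p∧x≢y⇒x∈p-y (x∈p∧x≢y⇒x∈p-y (∈-moves⁻ x∈) x≢v) x≢u)

  left-takes-other : ∀ {k} → PairingBound k →
    ∀ {V A B x} → ∣ V - v - u ∣ ≡ suc k → Pairable V A B → x ∈ V - v - u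
    → leftMove (2 + k) V A B x ≤R leftMove k (V - v - u) (pairedL A) (pairedR B) x
  left-takes-other {k} ih {V} {A} {B} {x} ∣W∣≡1+k P x∈W =
    ≤-leftMove k (V - v - u) (pairedL A) (pairedR B) x λ ¬win → begin
      leftMove (2 + k) V A B x
        ≡⟨ leftMove-continue (2 + k) V A B x (¬win ∘ fills-pairedL u≢x A ∘ fills-plus A) ⟩
      value (2 + k) Right (V - x) (plus x A) (minus x B)
        ≲⟨ ih Right (∣p-x-y-z∣≡k ∣W∣≡1+k x∈W) (Pairable-leftMove x∈W ¬win P) ⟩
      value k Right (V - x - v - u) (pairedL (plus x A)) (pairedR (minus x B))
        ≡⟨ cong (λ W → value k Right W (pairedL (plus x A)) (pairedR (minus x B))) (p-x-y-z≡p-y-z-x V x v u) ⟩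
      value k Right (V - v - u - x) (pairedL (plus x A)) (pairedR (minus x B))
        ≲⟨ value-mono k Right (V - v - u - x) (pairedL-plus u≢x A) (minus-pairedR x≢u B) ⟩
      value k Right (V - v - u - x) (plus x (pairedL A)) (minus x (pairedR B)) ∎
    where
    open ≤R-Reasoning
    x≢u = x∈p-y⇒x≢y x∈W
    u≢x = x≢u ∘ sym

  right-bound-zero : ∀ {V A B} → ∣ V - v - u ∣ ≡ 0 → Pairable V A B → value 2 Right V A B ≤R Draw
  right-bound-zero {V} {A} {B} ∣W∣≡0 P = begin
    value 2 Right V A B  ≲⟨ bestR-lb (rightMove 1 V A B) (∈-moves⁺ (u∈V P)) ⟩
    rightMove 1 V A B u  ≲⟨ rightMove-≤ 1 V A B u (λ _ → bestL-lub (leftMove 0 V-u A-u B+u) v∈ bound) ⟩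
    Draw                 ∎
    where
    open ≤R-Reasoning
    v∈ = ∈-moves⁺ (x∈p∧x≢y⇒x∈p-y (v∈V P) v≢u)
    V-u = V - u
    A-u = minus u A
    B+u = plus u B
    bound : ∀ {y} → y ∈ₗ moves V-u → leftMove 0 V-u A-u B+u y ≤R Draw
    bound {y} y∈ with y ≟ v
    ... | yes refl = ≤R-reflexive (leftMove-continue 0 V-u A-u B+u v (v-loses P ∘ fills-mono (minus-⊆ u A)))
    ... | no  y≢v  = contradiction ∣W∣≡0 (x∈p⇒∣p∣≢0 y∈W)
      where
      y∈W : y ∈ V - v - u
      y∈W = subst (y ∈_) (p─x─y≡p─y─x V u v) (x∈p∧x≢y⇒x∈p-y (∈-moves⁻ y∈) y≢v)

  right-takes-other : ∀ {k} → PairingBound k →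
    ∀ {V A B y} → ∣ V - v - u ∣ ≡ suc k → Pairable V A B → y ∈ V - v - u
    → rightMove (2 + k) V A B y ≤R rightMove k (V - v - u) (pairedL A) (pairedR B) y
  right-takes-other {k} ih {V} {A} {B} {y} ∣W∣≡1+k P y∈W =
    rightMove-≤ (2 + k) V A B y λ ¬win → begin
      value (2 + k) Left (V - y) (minus y A) (plus y B)
        ≲⟨ ih Left (∣p-x-y-z∣≡k ∣W∣≡1+k y∈W) (Pairable-rightMove y∈W P) ⟩
      value k Left (V - y - v - u) (pairedL (minus y A)) (pairedR (plus y B))
        ≡⟨ cong (λ W → value k Left W (pairedL (minus y A)) (pairedR (plus y B))) (p-x-y-z≡p-y-z-x V y v u) ⟩
      value k Left (V - v - u - y) (pairedL (minus y A)) (pairedR (plus y B))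
        ≲⟨ value-mono k Left (V - v - u - y) (pairedL-minus A) (plus-pairedR B) ⟩
      value k Left (V - v - u - y) (minus y (pairedL A)) (plus y (pairedR B))
        ≡⟨ rightMove-continue k (V - v - u) (pairedL A) (pairedR B) y
             (¬win ∘ fills-mono (pairedR-⊆ (dominatedR P))) ⟨
      rightMove k (V - v - u) (pairedL A) (pairedR B) y ∎
    where open ≤R-Reasoning

  right-bound : ∀ {k} → PairingBound k → ∀ {V A B} → ∣ V - v - u ∣ ≡ suc k → Pairable V A B
    → value (3 + k) Right V A B ≤R value (suc k) Right (V - v - u) (pairedL A) (pairedR B)
  right-bound {k} ih {V} {A} {B} ∣W∣≡1+k P =
    bestR-glb (rightMove k (V - v - u) (pairedL A) (pairedR B)) (∈-moves⁺ (proj₂ (∣p∣≡1+k⇒Nonempty ∣W∣≡1+k))) bound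
    where
    bound : ∀ {y} → y ∈ₗ moves (V - v - u)
      → value (3 + k) Right V A B ≤R rightMove k (V - v - u) (pairedL A) (pairedR B) y
    bound y∈ = ≤R-trans (bestR-lb (rightMove (2 + k) V A B) (∈-moves⁺ (x∈p-y⇒x∈p (x∈p-y⇒x∈p y∈W))))
                        (right-takes-other ih ∣W∣≡1+k P y∈W)
      where y∈W = ∈-moves⁻ y∈

  pairing-bound : ∀ k → PairingBound k
  pairing-bound zero    Left  ∣W∣≡0   P = left-bound 0 P (λ x∈W → contradiction ∣W∣≡0 (x∈p⇒∣p∣≢0 x∈W))
  pairing-bound (suc k) Left  ∣W∣≡1+k P = left-bound (suc k) P λ x∈W →
    ≤R-trans (left-takes-other (pairing-bound k) ∣W∣≡1+k P x∈W) (bestL-ub _ (∈-moves⁺ x∈W))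
  pairing-bound zero    Right ∣W∣≡0   P = right-bound-zero ∣W∣≡0 P
  pairing-bound (suc k) Right ∣W∣≡1+k P = right-bound (pairing-bound k) ∣W∣≡1+k P

  pairing-result : ∀ p (G : Game n) → Pairable (V G) (EL G) (ER G) → result p G ≤R result p (after G v u)
  pairing-result p (game V EL ER) P =
    subst (λ m → value m p V EL ER ≤R result p (after (game V EL ER) v u)) (sym ∣V∣≡2+∣W∣)
          (pairing-bound (∣ V - v - u ∣) p refl P)
    where
    ∣V∣≡2+∣W∣ : ∣ V ∣ ≡ 2 + ∣ V - v - u ∣
    ∣V∣≡2+∣W∣ = trans (x∈p⇒∣p∣≡1+∣p-x∣ (v∈V P))
                      (cong suc (x∈p⇒∣p∣≡1+∣p-x∣ (x∈p∧x≢y⇒x∈p-y (u∈V P) u≢v)))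

  pairing-result-red : ∀ p (G : Game n) → Pairable (V G) (ER G) (EL G) → result p (after G u v) ≤R result p G
  pairing-result-red p G P = begin
    result p (after G u v)                                  ≡⟨ result-swap p (after G u v) ⟩
    negR (result (opponent p) (swap (after G u v)))         ≡⟨ cong (negR ∘ result (opponent p)) (after-swap G u v) ⟨
    negR (result (opponent p) (after (swap G) v u))         ≲⟨ negR-antitone (pairing-result (opponent p) (swap G) P) ⟩
    negR (result (opponent p) (swap G))                     ≡⟨ result-swap p G ⟨
    result p G                                              ∎
    where open ≤R-Reasoning

singleton-free⇒¬fills : (∀ {e} → e ∈ₗ E → Nonempty e × ∣ e ∣ ≢ 1) → ¬ T (fills v E)
singleton-free⇒¬fills {E = E} proper win with fills⁻ E win
... | e , e∈ , empty = proj₂ (proper e∈) (Nonempty∧Empty[p-x]⇒∣p∣≡1 (proj₁ (proper e∈)) empty)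

pair-edge-ends : (E : List (Subset n)) (V : Subset n) → (∀ e → e ∈ₗ E → Nonempty e × e ⊆ V)
  → (∀ e → e ∈ₗ E → ∣ e ∣ ≢ 1) → ⁅ u ⁆ ∪ ⁅ v ⁆ ∈ₗ E → v ≢ u × u ∈ V × v ∈ V
pair-edge-ends {u = u} {v} E V wf no1 uv∈ =
  (λ { refl → no1 _ uv∈ (trans (cong ∣_∣ (∪-idem ⁅ u ⁆)) (∣⁅x⁆∣≡1 u)) })
  , proj₂ (wf _ uv∈) (x∈p∪q⁺ (inj₁ (x∈⁅x⁆ u)))
  , proj₂ (wf _ uv∈) (x∈p∪q⁺ (inj₂ (x∈⁅x⁆ v)))

edge⇒Pairable : ∀ (G : Game n) {A B} → WellFormed G → (∀ e → e ∈ₗ EL G ++ ER G → ∣ e ∣ ≢ 1)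
  → (∀ e → e ∈ₗ EL G ++ ER G → u ∈ e → v ∈ e) → ⁅ u ⁆ ∪ ⁅ v ⁆ ∈ₗ EL G ++ ER G
  → A ⊆ₗ EL G ++ ER G → B ⊆ₗ EL G ++ ER G → ∃ λ (v≢u : v ≢ u) → Pairing.Pairable v≢u (V G) A B
edge⇒Pairable G wf no1 dom uv∈ A⊆ B⊆ with pair-edge-ends (EL G ++ ER G) (V G) wf no1 uv∈
... | v≢u , u∈V , v∈V = v≢u , record
  { u∈V        = u∈V
  ; v∈V        = v∈V
  ; dominatedL = dom _ ∘ A⊆
  ; dominatedR = dom _ ∘ B⊆
  ; v-loses    = singleton-free⇒¬fills λ e∈ → proj₁ (wf _ (A⊆ e∈)) , no1 _ (A⊆ e∈)
  }

lemma3p8 : ∀ {n} (G : Game n) → WellFormed G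
    → (∀ e → e ∈ₗ (EL G ++ ER G) → ∣ e ∣ ≢ 1)
    → (u v : Fin n)
    → (∀ e → e ∈ₗ (EL G ++ ER G) → u ∈ e → v ∈ e)
    → ((⁅ u ⁆ ∪ ⁅ v ⁆ ∈ₗ EL G → o G ≤L o (after G v u))
    × (⁅ u ⁆ ∪ ⁅ v ⁆ ∈ₗ ER G → o (after G u v) ≤L o G))
lemma3p8 G wf no1 u v dom = blue ∘ ∈-++⁺ˡ , red ∘ ∈-++⁺ʳ (EL G)
  where
  blue : ⁅ u ⁆ ∪ ⁅ v ⁆ ∈ₗ EL G ++ ER G → o G ≤L o (after G v u)
  blue uv∈ with edge⇒Pairable G wf no1 dom uv∈ ∈-++⁺ˡ (∈-++⁺ʳ (EL G))
  ... | v≢u , P = Pairing.pairing-result v≢u Left G P , Pairing.pairing-result v≢u Right G P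
  red : ⁅ u ⁆ ∪ ⁅ v ⁆ ∈ₗ EL G ++ ER G → o (after G u v) ≤L o G
  red uv∈ with edge⇒Pairable G wf no1 dom uv∈ (∈-++⁺ʳ (EL G)) ∈-++⁺ˡ
  ... | v≢u , P = Pairing.pairing-result-red v≢u Left G P , Pairing.pairing-result-red v≢u Right G P
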